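{- Let $G$ be a $2$-tree. Then for some $k\geq1$, $V(G)$ can be partitioned into sets $(S_0,S_1,\dots,S_k)$ such that: (a) for $1\leq i\leq k$, the induced subgraph $G_i=G[\bigcup_{j=0}^iS_j]$ is a $2$-tree; (b) $S_0$ consists of two adjacent vertices; (c) for $1\leq i\leq k$, $S_i$ is an independent set of $G$; (d) for $1\leq i\leq k$, each vertex in $S_i$ has exactly two neighbours in $G_{i-1}$, and these two neighbours are adjacent; (e) for $2\leq i\leq k$, the vertices in $S_i$ have a common neighbour $v$ in $G_{i-1}$, and $v$ has degree two in $G_{i-1}$.
   Context: The $2$-trees are defined recursively: $K_3$ is a $2$-tree, and adding a new vertex adjacent to both endpoints of an existing edge of a $2$-tree yields a $2$-tree. Here $G_0=G[S_0]$. -}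

module Defs where

open import Data.Nat using (ℕ; zero; suc; _≤_; _∸_)
open import Data.Fin using (Fin; toℕ)
open import Data.Product using (Σ; ∃; _×_; _,_)
open import Data.Sum using (_⊎_)
open import Data.Unit using (⊤)
open import Relation.Nullary using (¬_)
open import Relation.Binary.PropositionalEquality using (_≡_; _≢_)
open import Function.Bundles using (_⇔_)

record Graph (n : ℕ) : Set₁ where
  field
    Adj    : Fin n → Fin n → Set
    sym    : ∀ {u v} → Adj u v → Adj v u
    irrefl : ∀ {v} → ¬ Adj v v
open Graph public

VSet : ℕ → Set₁
VSet n = Fin n → Set

-- TwoTreeOn G S : the induced subgraph G[S] is a 2-tree.
data TwoTreeOn {n : ℕ} (G : Graph n) : VSet n → Set₁ where
  triangle : ∀ {S} (a b c : Fin n) →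
             a ≢ b → b ≢ c → a ≢ c →
             Adj G a b → Adj G b c → Adj G a c →
             (∀ w → S w ⇔ (w ≡ a ⊎ w ≡ b ⊎ w ≡ c)) →
             TwoTreeOn G S
  extend   : ∀ {S S′} (x u v : Fin n) →
             TwoTreeOn G S →
             ¬ S x → S u → S v → Adj G u v →
             Adj G x u → Adj G x v →
             (∀ w → S w → Adj G x w → w ≡ u ⊎ w ≡ v) →
             (∀ w → S′ w ⇔ (S w ⊎ w ≡ x)) →
             TwoTreeOn G S′

IsTwoTree : ∀ {n} → Graph n → Set₁
IsTwoTree G = TwoTreeOn G (λ _ → ⊤)

NbrsExactly : ∀ {n} → Graph n → VSet n → Fin n → Fin n → Fin n → Set
NbrsExactly G P x u w =
  u ≢ w × P u × P w × Adj G x u × Adj G x w ×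
  (∀ z → P z → Adj G x z → z ≡ u ⊎ z ≡ w)

DegreeTwoIn : ∀ {n} → Graph n → VSet n → Fin n → Set
DegreeTwoIn G P x = Σ (Fin _) λ u → Σ (Fin _) λ w → NbrsExactly G P x u w

Upto : ∀ {n k} → (Fin (suc k) → VSet n) → ℕ → VSet n
Upto S i v = Σ (Fin _) λ j → toℕ j ≤ i × S j v

IsPartition : ∀ {n k} → (Fin (suc k) → VSet n) → Set
IsPartition {n} {k} S =
  (∀ v → Σ (Fin (suc k)) λ i → S i v) ×
  (∀ i j v → S i v → S j v → i ≡ j) ×
  (∀ i → Σ (Fin n) λ v → S i v)

-- The levels are built along the recursive construction of the 2-tree. Level 0 is an edge ab and
-- level 1 holds the vertices glued onto ab; every level l ≥ 2 has a centre c_l of degree two below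
-- it, and its vertices are glued onto edges at c_l. Each edge uv carries an anchor: the level that
-- receives the vertices later glued onto uv. A new vertex x glued onto uv joins the anchor level of
-- uv and opens a new top level with centre x, which anchors the edges xu and xv. The centres of all
-- levels above the anchor of uv differ from u and v, so x is never adjacent to such a centre and
-- every centre keeps degree two below its level. The levels that stay empty are deleted at the end.

module Submission where

open import Defs
open import Data.Nat using (ℕ; zero; suc; _≤_; _<_; _∸_; z≤n; s≤s; _≟_; _<?_; _≤?_)
open import Data.Nat.Properties
open import Data.Fin as Fin using (Fin; toℕ; fromℕ<)
open import Data.Fin.Properties using (any?; toℕ-fromℕ<; toℕ-injective; toℕ<n)
open import Data.Product as Product using (Σ; ∃; ∃₂; _×_; _,_; proj₁; proj₂)
open import Data.Sum as ⊎ using (_⊎_; inj₁; inj₂)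
open import Data.Unit using (⊤; tt)
open import Relation.Nullary using (¬_; Dec; yes; no; contradiction)
open import Relation.Nullary.Decidable using (_×-dec_; _⊎-dec_; ¬?; decidable-stable)
open import Relation.Unary using (_⊆′_; _≐′_)
open import Relation.Unary.Properties using (≐′-refl; ≐′-sym; ≐′-trans)
open import Relation.Binary.PropositionalEquality as ≡ using (_≡_; _≢_; refl; subst)
open import Function.Base using (_∘′_)
open import Function.Bundles using (_⇔_; mk⇔; Equivalence)

module LevelStructure {n : ℕ} (G : Graph n) where

  Levels : Set₁
  Levels = ℕ → VSet n

  Prefix : Levels → ℕ → VSet n
  Prefix L i v = ∃ λ j → j ≤ i × L j v

  prefix-mono : ∀ {L i i′} → i ≤ i′ → Prefix L i ⊆′ Prefix L i′
  prefix-mono i≤i′ _ (j , j≤i , v∈L) = j , ≤-trans j≤i i≤i′ , v∈L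

  ⇔-respˡ-≐ : ∀ {A B : VSet n} {P : Fin n → Set} → A ≐′ B → (∀ w → A w ⇔ P w) → (∀ w → B w ⇔ P w)
  ⇔-respˡ-≐ (A⊆B , B⊆A) A⇔P w =
    mk⇔ (Equivalence.to (A⇔P w) ∘′ B⊆A w) (A⊆B w ∘′ Equivalence.from (A⇔P w))

  twoTree-resp-≐ : ∀ {A B} → A ≐′ B → TwoTreeOn G A → TwoTreeOn G B
  twoTree-resp-≐ A≐B (triangle a b c a≢b b≢c a≢c a~b b~c a~c A⇔) =
    triangle a b c a≢b b≢c a≢c a~b b~c a~c (⇔-respˡ-≐ A≐B A⇔)
  twoTree-resp-≐ A≐B (extend x u v t x∉S u∈S v∈S u~v x~u x~v x-nbrs A⇔) =
    extend x u v t x∉S u∈S v∈S u~v x~u x~v x-nbrs (⇔-respˡ-≐ A≐B A⇔)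

  nbrsExactly-widen : ∀ {A B x u w} → A ⊆′ B → (∀ z → B z → Adj G x z → A z) →
                      NbrsExactly G A x u w → NbrsExactly G B x u w
  nbrsExactly-widen A⊆B B∩N⊆A (u≢w , u∈A , w∈A , x~u , x~w , only) =
    u≢w , A⊆B _ u∈A , A⊆B _ w∈A , x~u , x~w , λ z z∈B x~z → only z (B∩N⊆A z z∈B x~z) x~z

  nbrsExactly-resp-≐ : ∀ {A B x u w} → A ≐′ B → NbrsExactly G A x u w → NbrsExactly G B x u w
  nbrsExactly-resp-≐ (A⊆B , B⊆A) = nbrsExactly-widen A⊆B (λ z z∈B _ → B⊆A z z∈B)

  degreeTwo-resp-≐ : ∀ {A B x} → A ≐′ B → DegreeTwoIn G A x → DegreeTwoIn G B x
  degreeTwo-resp-≐ A≐B (u , w , nbrs) = u , w , nbrsExactly-resp-≐ A≐B nbrs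

  HasCentre : Levels → ℕ → Set
  HasCentre L i = ∃ λ v → Prefix L (i ∸ 1) v × (∀ x → L i x → Adj G x v) × DegreeTwoIn G (Prefix L (i ∸ 1)) v

  record Levelling (T : VSet n) (K : ℕ) (L : Levels) : Set₁ where
    field
      1≤K               : 1 ≤ K
      level?            : ∀ j v → Dec (L j v)
      level≤K           : ∀ j v → L j v → j ≤ K
      covers            : ∀ v → T v → ∃ λ j → L j v
      within            : ∀ j v → L j v → T v
      disjoint          : ∀ i j v → L i v → L j v → i ≡ j
      a b               : Fin n
      a~b               : Adj G a b
      level₀            : ∀ v → L 0 v ⇔ (v ≡ a ⊎ v ≡ b)
      level₁-nonempty   : ∃ (L 1)
      prefix-twoTree    : ∀ i → 1 ≤ i → TwoTreeOn G (Prefix L i)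
      level-independent : ∀ i → 1 ≤ i → ∀ u v → L i u → L i v → ¬ Adj G u v
      level-attached    : ∀ i → 1 ≤ i → ∀ x → L i x → ∃₂ λ u w →
                            NbrsExactly G (Prefix L (i ∸ 1)) x u w × Adj G u w

    prefix-within : ∀ i → Prefix L i ⊆′ T
    prefix-within i w (j , _ , w∈L) = within j w w∈L

    not-in-earlier-prefix : ∀ {i w} → 1 ≤ i → L i w → ¬ Prefix L (i ∸ 1) w
    not-in-earlier-prefix {suc i} _ w∈Lᵢ (j , j≤i , w∈Lⱼ) with disjoint j (suc i) _ w∈Lⱼ w∈Lᵢ
    ... | refl = 1+n≰n j≤i

  record Decomposition (K : ℕ) (L : Levels) : Set₁ where
    field
      levelling : Levelling (λ _ → ⊤) K L
      centred   : ∀ i → 2 ≤ i → i ≤ K → HasCentre L i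
    open Levelling levelling public

  record Anchor (K : ℕ) (L : Levels) (centre : ℕ → Fin n) (u v : Fin n) : Set where
    field
      j                   : ℕ
      1≤j                 : 1 ≤ j
      j≤K                 : j ≤ K
      u∈prefix            : Prefix L (j ∸ 1) u
      v∈prefix            : Prefix L (j ∸ 1) v
      centre-endpoint     : 2 ≤ j → centre j ≡ u ⊎ centre j ≡ v
      later-centres-avoid : ∀ l → j < l → l ≤ K → centre l ≢ u × centre l ≢ v

  anchor-swap : ∀ {K L centre u v} → Anchor K L centre u v → Anchor K L centre v u
  anchor-swap α = record
    { j = j ; 1≤j = 1≤j ; j≤K = j≤K ; u∈prefix = v∈prefix ; v∈prefix = u∈prefix
    ; centre-endpoint = ⊎.swap ∘′ centre-endpoint
    ; later-centres-avoid = λ l j<l l≤K → Product.swap (later-centres-avoid l j<l l≤K)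
    }
    where open Anchor α

  record Layering (T : VSet n) : Set₁ where
    field
      K                 : ℕ
      level             : Levels
      centre            : ℕ → Fin n
      levelling         : Levelling T K level
      centre-in-prefix  : ∀ j → 2 ≤ j → j ≤ K → Prefix level (j ∸ 1) (centre j)
      centre-degree-two : ∀ j → 2 ≤ j → j ≤ K → DegreeTwoIn G (Prefix level (j ∸ 1)) (centre j)
      centre-adjacent   : ∀ j → 2 ≤ j → ∀ x → level j x → Adj G x (centre j)
      anchor            : ∀ u v → T u → T v → Adj G u v → Anchor K level centre u v
    open Levelling levelling public

  module Triangle (a b c : Fin n) (a≢b : a ≢ b) (b≢c : b ≢ c) (a≢c : a ≢ c)
                  (a~b : Adj G a b) (b~c : Adj G b c) (a~c : Adj G a c)
                  {T : VSet n} (T≐ : ∀ w → T w ⇔ (w ≡ a ⊎ w ≡ b ⊎ w ≡ c)) where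

    level : Levels
    level i w = (i ≡ 0 × (w ≡ a ⊎ w ≡ b)) ⊎ (i ≡ 1 × w ≡ c)

    centre : ℕ → Fin n
    centre _ = c

    a∈prefix : ∀ i → Prefix level i a
    a∈prefix i = 0 , z≤n , inj₁ (refl , inj₁ refl)

    b∈prefix : ∀ i → Prefix level i b
    b∈prefix i = 0 , z≤n , inj₁ (refl , inj₂ refl)

    c∈prefix : ∀ {i} → 1 ≤ i → Prefix level i c
    c∈prefix 1≤i = 1 , 1≤i , inj₂ (refl , refl)

    prefix≐ : ∀ i → 1 ≤ i → ∀ w → Prefix level i w ⇔ (w ≡ a ⊎ w ≡ b ⊎ w ≡ c)
    prefix≐ i 1≤i w = mk⇔ to from
      where
        to : Prefix level i w → w ≡ a ⊎ w ≡ b ⊎ w ≡ c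
        to (_ , _ , inj₁ (_ , inj₁ w≡a)) = inj₁ w≡a
        to (_ , _ , inj₁ (_ , inj₂ w≡b)) = inj₂ (inj₁ w≡b)
        to (_ , _ , inj₂ (_ , w≡c))      = inj₂ (inj₂ w≡c)
        from : w ≡ a ⊎ w ≡ b ⊎ w ≡ c → Prefix level i w
        from (inj₁ refl)        = a∈prefix i
        from (inj₂ (inj₁ refl)) = b∈prefix i
        from (inj₂ (inj₂ refl)) = c∈prefix 1≤i

    level⊆T : ∀ j w → level j w → T w
    level⊆T j w w∈L = Equivalence.from (T≐ w) (Equivalence.to (prefix≐ 1 ≤-refl w) (j , lemma w∈L , w∈L))
      where
        lemma : level j w → j ≤ 1
        lemma (inj₁ (refl , _)) = z≤n
        lemma (inj₂ (refl , _)) = ≤-refl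

    levelling : Levelling T 2 level
    levelling = record
      { 1≤K = s≤s z≤n
      ; level? = λ j v → ((j ≟ 0) ×-dec ((v Fin.≟ a) ⊎-dec (v Fin.≟ b))) ⊎-dec ((j ≟ 1) ×-dec (v Fin.≟ c))
      ; level≤K = λ { _ _ (inj₁ (refl , _)) → z≤n ; _ _ (inj₂ (refl , _)) → s≤s z≤n }
      ; covers = covers
      ; within = level⊆T
      ; disjoint = disjoint
      ; a = a ; b = b ; a~b = a~b
      ; level₀ = λ v → mk⇔ (λ { (inj₁ (_ , v∈ab)) → v∈ab ; (inj₂ (() , _)) }) (λ v∈ab → inj₁ (refl , v∈ab))
      ; level₁-nonempty = c , inj₂ (refl , refl)
      ; prefix-twoTree = λ i 1≤i → triangle a b c a≢b b≢c a≢c a~b b~c a~c (prefix≐ i 1≤i)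
      ; level-independent = independent
      ; level-attached = attached
      }
      where
        covers : ∀ v → T v → ∃ λ j → level j v
        covers v v∈T with Equivalence.to (T≐ v) v∈T
        ... | inj₁ v≡a        = 0 , inj₁ (refl , inj₁ v≡a)
        ... | inj₂ (inj₁ v≡b) = 0 , inj₁ (refl , inj₂ v≡b)
        ... | inj₂ (inj₂ v≡c) = 1 , inj₂ (refl , v≡c)

        disjoint : ∀ i j v → level i v → level j v → i ≡ j
        disjoint _ _ _ (inj₁ (refl , _)) (inj₁ (refl , _)) = refl
        disjoint _ _ _ (inj₂ (refl , _)) (inj₂ (refl , _)) = refl
        disjoint _ _ _ (inj₁ (_ , inj₁ refl)) (inj₂ (_ , refl)) = contradiction refl a≢c
        disjoint _ _ _ (inj₁ (_ , inj₂ refl)) (inj₂ (_ , refl)) = contradiction refl b≢c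
        disjoint _ _ _ (inj₂ (_ , refl)) (inj₁ (_ , inj₁ refl)) = contradiction refl a≢c
        disjoint _ _ _ (inj₂ (_ , refl)) (inj₁ (_ , inj₂ refl)) = contradiction refl b≢c

        independent : ∀ i → 1 ≤ i → ∀ u v → level i u → level i v → ¬ Adj G u v
        independent _ () _ _ (inj₁ (refl , _)) _
        independent _ _ _ _ (inj₂ (refl , refl)) (inj₂ (_ , refl)) = irrefl G
        independent _ _ _ _ (inj₂ (refl , _)) (inj₁ (() , _))

        c-nbrs : NbrsExactly G (Prefix level 0) c a b
        c-nbrs = a≢b , a∈prefix 0 , b∈prefix 0 , Graph.sym G a~c , Graph.sym G b~c , only
          where
            only : ∀ z → Prefix level 0 z → Adj G c z → z ≡ a ⊎ z ≡ b
            only z (.0 , z≤n , inj₁ (_ , z∈ab)) _ = z∈ab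
            only z (.0 , z≤n , inj₂ (() , _)) _

        attached : ∀ i → 1 ≤ i → ∀ x → level i x → ∃₂ λ u w →
                     NbrsExactly G (Prefix level (i ∸ 1)) x u w × Adj G u w
        attached _ () _ (inj₁ (refl , _))
        attached _ _ _ (inj₂ (refl , refl)) = a , b , c-nbrs , a~b

    ab-anchor : Anchor 2 level centre a b
    ab-anchor = record
      { j = 1 ; 1≤j = ≤-refl ; j≤K = s≤s z≤n ; u∈prefix = a∈prefix 0 ; v∈prefix = b∈prefix 0
      ; centre-endpoint = λ { (s≤s ()) }
      ; later-centres-avoid = λ _ _ _ → (λ c≡a → a≢c (≡.sym c≡a)) , (λ c≡b → b≢c (≡.sym c≡b))
      }

    c-anchor : ∀ {w} → Prefix level 1 w → Anchor 2 level centre c w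
    c-anchor w∈prefix = record
      { j = 2 ; 1≤j = s≤s z≤n ; j≤K = ≤-refl ; u∈prefix = c∈prefix ≤-refl ; v∈prefix = w∈prefix
      ; centre-endpoint = λ _ → inj₁ refl
      ; later-centres-avoid = λ _ 2<l l≤2 → contradiction (≤-trans 2<l l≤2) (1+n≰n)
      }

    anchor : ∀ u v → T u → T v → Adj G u v → Anchor 2 level centre u v
    anchor u v u∈T v∈T u~v with Equivalence.to (T≐ u) u∈T | Equivalence.to (T≐ v) v∈T
    ... | inj₁ refl        | inj₁ refl        = contradiction u~v (irrefl G)
    ... | inj₁ refl        | inj₂ (inj₁ refl) = ab-anchor
    ... | inj₁ refl        | inj₂ (inj₂ refl) = anchor-swap (c-anchor (a∈prefix 1))
    ... | inj₂ (inj₁ refl) | inj₁ refl        = anchor-swap ab-anchor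
    ... | inj₂ (inj₁ refl) | inj₂ (inj₁ refl) = contradiction u~v (irrefl G)
    ... | inj₂ (inj₁ refl) | inj₂ (inj₂ refl) = anchor-swap (c-anchor (b∈prefix 1))
    ... | inj₂ (inj₂ refl) | inj₁ refl        = c-anchor (a∈prefix 1)
    ... | inj₂ (inj₂ refl) | inj₂ (inj₁ refl) = c-anchor (b∈prefix 1)
    ... | inj₂ (inj₂ refl) | inj₂ (inj₂ refl) = contradiction u~v (irrefl G)

    layering : Layering T
    layering = record
      { K = 2 ; level = level ; centre = centre ; levelling = levelling
      ; centre-in-prefix = λ j 2≤j _ → c∈prefix (∸-monoˡ-≤ 1 2≤j)
      ; centre-degree-two = centre-degree-two
      ; centre-adjacent = centre-adjacent
      ; anchor = anchor
      }
      where
        centre-adjacent : ∀ j → 2 ≤ j → ∀ x → level j x → Adj G x c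
        centre-adjacent _ () _ (inj₁ (refl , _))
        centre-adjacent _ (s≤s ()) _ (inj₂ (refl , _))

        centre-degree-two : ∀ j → 2 ≤ j → j ≤ 2 → DegreeTwoIn G (Prefix level (j ∸ 1)) c
        centre-degree-two j 2≤j j≤2 with ≤-antisym j≤2 2≤j
        ... | refl = a , b , a≢b , a∈prefix 1 , b∈prefix 1 , Graph.sym G a~c , Graph.sym G b~c , only
          where
            only : ∀ z → Prefix level 1 z → Adj G c z → z ≡ a ⊎ z ≡ b
            only z z∈prefix c~z with Equivalence.to (prefix≐ 1 ≤-refl z) z∈prefix
            ... | inj₁ z≡a        = inj₁ z≡a
            ... | inj₂ (inj₁ z≡b) = inj₂ z≡b
            ... | inj₂ (inj₂ refl) = contradiction c~z (irrefl G)

  update : (ℕ → Fin n) → ℕ → Fin n → ℕ → Fin n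
  update f m y i with i ≟ m
  ... | yes _ = y
  ... | no _  = f i

  update-at : ∀ f m y → update f m y m ≡ y
  update-at f m y with m ≟ m
  ... | yes _   = refl
  ... | no m≢m = contradiction refl m≢m

  update-below : ∀ f m y {i} → i < m → update f m y i ≡ f i
  update-below f m y {i} i<m with i ≟ m
  ... | yes refl = contradiction i<m (<-irrefl refl)
  ... | no _     = refl

  module Extend {T T′ : VSet n} (Λ : Layering T) (x u v : Fin n) (x∉T : ¬ T x) (u∈T : T u) (v∈T : T v)
                (u~v : Adj G u v) (x~u : Adj G x u) (x~v : Adj G x v)
                (x-nbrs : ∀ w → T w → Adj G x w → w ≡ u ⊎ w ≡ v)
                (T′≐ : ∀ w → T′ w ⇔ (T w ⊎ w ≡ x)) where
    open Layering Λ
    open Anchor (anchor u v u∈T v∈T u~v)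

    level′ : Levels
    level′ i w = level i w ⊎ (i ≡ j × w ≡ x)

    centre′ : ℕ → Fin n
    centre′ = update centre (suc K) x

    centre′-old : ∀ {l} → l ≤ K → centre′ l ≡ centre l
    centre′-old l≤K = update-below centre (suc K) x (s≤s l≤K)

    centre′-new : centre′ (suc K) ≡ x
    centre′-new = update-at centre (suc K) x

    x∈level′ : level′ j x
    x∈level′ = inj₂ (refl , refl)

    j∸1≤ : ∀ {m} → j ≤ m → j ∸ 1 ≤ m
    j∸1≤ = ≤-trans (m∸n≤m j 1)

    x∉prefix : ∀ m → ¬ Prefix level m x
    x∉prefix m x∈prefix = x∉T (prefix-within m x x∈prefix)

    T⊆prefix : ∀ w → T w → Prefix level K w
    T⊆prefix w w∈T = let (i , w∈L) = covers w w∈T in i , level≤K i w w∈L , w∈L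

    prefix-embed : ∀ m → Prefix level m ⊆′ Prefix level′ m
    prefix-embed m w (i , i≤m , w∈L) = i , i≤m , inj₁ w∈L

    prefix-before : ∀ m → m < j → Prefix level′ m ⊆′ Prefix level m
    prefix-before m m<j w (i , i≤m , inj₁ w∈L)       = i , i≤m , w∈L
    prefix-before m m<j w (i , i≤m , inj₂ (refl , _)) = contradiction (≤-trans m<j i≤m) (1+n≰n)

    prefix-after : ∀ m → j ≤ m → ∀ w → Prefix level′ m w ⇔ (Prefix level m w ⊎ w ≡ x)
    prefix-after m j≤m w = mk⇔ to from
      where
        to : Prefix level′ m w → Prefix level m w ⊎ w ≡ x
        to (i , i≤m , inj₁ w∈L)        = inj₁ (i , i≤m , w∈L)
        to (i , i≤m , inj₂ (_ , w≡x)) = inj₂ w≡x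
        from : Prefix level m w ⊎ w ≡ x → Prefix level′ m w
        from (inj₁ w∈prefix) = prefix-embed m w w∈prefix
        from (inj₂ refl)     = j , j≤m , x∈level′

    x-nbrs-in-prefix : ∀ w → T w → Adj G x w → Prefix level (j ∸ 1) w
    x-nbrs-in-prefix w w∈T x~w with x-nbrs w w∈T x~w
    ... | inj₁ refl = u∈prefix
    ... | inj₂ refl = v∈prefix

    nbrs-lift : ∀ m y s t → (j ≤ m → ¬ Adj G y x) →
                NbrsExactly G (Prefix level m) y s t → NbrsExactly G (Prefix level′ m) y s t
    nbrs-lift m y s t y≁x = nbrsExactly-widen (prefix-embed m) back
      where
        back : ∀ z → Prefix level′ m z → Adj G y z → Prefix level m z
        back z (i , i≤m , inj₁ z∈L)           _   = i , i≤m , z∈L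
        back z (i , i≤m , inj₂ (refl , refl)) y~x = contradiction y~x (y≁x i≤m)

    x-nbrs-exactly : ∀ m → j ∸ 1 ≤ m → NbrsExactly G (Prefix level′ m) x u v
    x-nbrs-exactly m j∸1≤m = nbrs-lift m x u v (λ _ → irrefl G)
      ( (λ { refl → irrefl G u~v }) , prefix-mono {level} j∸1≤m u u∈prefix , prefix-mono {level} j∸1≤m v v∈prefix
      , x~u , x~v , λ z z∈prefix → x-nbrs z (prefix-within m z z∈prefix))

    prefix-twoTree′ : ∀ i → 1 ≤ i → TwoTreeOn G (Prefix level′ i)
    prefix-twoTree′ i 1≤i with j ≤? i
    ... | yes j≤i = extend x u v (prefix-twoTree i 1≤i) (x∉prefix i)
                      (prefix-mono {level} (j∸1≤ j≤i) u u∈prefix) (prefix-mono {level} (j∸1≤ j≤i) v v∈prefix)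
                      u~v x~u x~v (λ w w∈prefix → x-nbrs w (prefix-within i w w∈prefix)) (prefix-after i j≤i)
    ... | no j≰i = twoTree-resp-≐ (prefix-embed i , prefix-before i (≰⇒> j≰i)) (prefix-twoTree i 1≤i)

    x≁level-j : ∀ y → level j y → ¬ Adj G x y
    x≁level-j y y∈Lⱼ x~y = not-in-earlier-prefix 1≤j y∈Lⱼ (x-nbrs-in-prefix y (within j y y∈Lⱼ) x~y)

    independent′ : ∀ i → 1 ≤ i → ∀ y z → level′ i y → level′ i z → ¬ Adj G y z
    independent′ i 1≤i y z (inj₁ y∈L)        (inj₁ z∈L)        = level-independent i 1≤i y z y∈L z∈L
    independent′ i 1≤i y z (inj₁ y∈L)        (inj₂ (refl , refl)) y~x = x≁level-j y y∈L (Graph.sym G y~x)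
    independent′ i 1≤i y z (inj₂ (refl , refl)) (inj₁ z∈L)     = x≁level-j z z∈L
    independent′ i 1≤i y z (inj₂ (_ , refl)) (inj₂ (_ , refl)) = irrefl G

    attached′ : ∀ i → 1 ≤ i → ∀ y → level′ i y → ∃₂ λ s t →
                  NbrsExactly G (Prefix level′ (i ∸ 1)) y s t × Adj G s t
    attached′ i 1≤i y (inj₁ y∈L) =
      let (s , t , nbrs , s~t) = level-attached i 1≤i y y∈L in s , t , nbrs-lift (i ∸ 1) y s t y≁x nbrs , s~t
      where
        y≁x : j ≤ i ∸ 1 → ¬ Adj G y x
        y≁x j≤i∸1 y~x = not-in-earlier-prefix 1≤i y∈L
          (prefix-mono {level} (j∸1≤ j≤i∸1) y (x-nbrs-in-prefix y (within i y y∈L) (Graph.sym G y~x)))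
    attached′ i 1≤i y (inj₂ (refl , refl)) = u , v , x-nbrs-exactly (j ∸ 1) ≤-refl , u~v

    levelling′ : Levelling T′ (suc K) level′
    levelling′ = record
      { 1≤K = s≤s z≤n
      ; level? = λ i w → level? i w ⊎-dec ((i ≟ j) ×-dec (w Fin.≟ x))
      ; level≤K = λ { i w (inj₁ w∈L) → m≤n⇒m≤1+n (level≤K i w w∈L) ; i w (inj₂ (refl , _)) → m≤n⇒m≤1+n j≤K }
      ; covers = covers′
      ; within = λ { i w (inj₁ w∈L) → Equivalence.from (T′≐ w) (inj₁ (within i w w∈L))
                   ; i w (inj₂ (_ , refl)) → Equivalence.from (T′≐ w) (inj₂ refl) }
      ; disjoint = disjoint′
      ; a = a ; b = b ; a~b = a~b
      ; level₀ = λ w → mk⇔ (level₀-to w) (inj₁ ∘′ Equivalence.from (level₀ w))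
      ; level₁-nonempty = let (w , w∈L) = level₁-nonempty in w , inj₁ w∈L
      ; prefix-twoTree = prefix-twoTree′
      ; level-independent = independent′
      ; level-attached = attached′
      }
      where
        covers′ : ∀ w → T′ w → ∃ λ i → level′ i w
        covers′ w w∈T′ with Equivalence.to (T′≐ w) w∈T′
        ... | inj₁ w∈T = let (i , w∈L) = covers w w∈T in i , inj₁ w∈L
        ... | inj₂ refl = j , x∈level′

        disjoint′ : ∀ i i′ w → level′ i w → level′ i′ w → i ≡ i′
        disjoint′ i i′ w (inj₁ w∈L)        (inj₁ w∈L′)       = disjoint i i′ w w∈L w∈L′
        disjoint′ i i′ w (inj₁ x∈L)        (inj₂ (_ , refl)) = contradiction (within i x x∈L) x∉T
        disjoint′ i i′ w (inj₂ (_ , refl)) (inj₁ x∈L)        = contradiction (within i′ x x∈L) x∉T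
        disjoint′ i i′ w (inj₂ (i≡j , _))  (inj₂ (i′≡j , _)) = ≡.trans i≡j (≡.sym i′≡j)

        level₀-to : ∀ w → level′ 0 w → w ≡ a ⊎ w ≡ b
        level₀-to w (inj₁ w∈L)       = Equivalence.to (level₀ w) w∈L
        level₀-to w (inj₂ (0≡j , _)) = contradiction (subst (1 ≤_) (≡.sym 0≡j) 1≤j) λ ()

    centre-in-prefix′ : ∀ l → 2 ≤ l → l ≤ suc K → Prefix level′ (l ∸ 1) (centre′ l)
    centre-in-prefix′ l 2≤l l≤1+K with m≤n⇒m<n∨m≡n l≤1+K
    ... | inj₁ (s≤s l≤K) = subst (Prefix level′ (l ∸ 1)) (≡.sym (centre′-old l≤K))
                             (prefix-embed (l ∸ 1) (centre l) (centre-in-prefix l 2≤l l≤K))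
    ... | inj₂ refl      = subst (Prefix level′ K) (≡.sym centre′-new) (j , j≤K , x∈level′)

    later-centre≁x : ∀ l → 2 ≤ l → j < l → l ≤ K → ¬ Adj G (centre l) x
    later-centre≁x l 2≤l j<l l≤K centre~x
      with x-nbrs (centre l) (prefix-within _ _ (centre-in-prefix l 2≤l l≤K)) (Graph.sym G centre~x)
    ... | inj₁ centre≡u = proj₁ (later-centres-avoid l j<l l≤K) centre≡u
    ... | inj₂ centre≡v = proj₂ (later-centres-avoid l j<l l≤K) centre≡v

    centre-degree-two′ : ∀ l → 2 ≤ l → l ≤ suc K → DegreeTwoIn G (Prefix level′ (l ∸ 1)) (centre′ l)
    centre-degree-two′ (suc l) 2≤l l≤1+K with m≤n⇒m<n∨m≡n l≤1+K
    ... | inj₁ (s≤s l<K) =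
      let (s , t , nbrs) = centre-degree-two (suc l) 2≤l l<K
      in subst (DegreeTwoIn G (Prefix level′ l)) (≡.sym (centre′-old l<K))
           (s , t , nbrs-lift l _ s t (λ j≤l → later-centre≁x (suc l) 2≤l (s≤s j≤l) l<K) nbrs)
    ... | inj₂ refl = subst (DegreeTwoIn G (Prefix level′ K)) (≡.sym centre′-new)
                        (u , v , x-nbrs-exactly K (j∸1≤ j≤K))

    centre-adjacent′ : ∀ l → 2 ≤ l → ∀ y → level′ l y → Adj G y (centre′ l)
    centre-adjacent′ l 2≤l y (inj₁ y∈L) =
      subst (Adj G y) (≡.sym (centre′-old (level≤K l y y∈L))) (centre-adjacent l 2≤l y y∈L)
    centre-adjacent′ l 2≤l y (inj₂ (refl , refl)) with centre-endpoint 2≤l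
    ... | inj₁ centre≡u = subst (Adj G x) (≡.sym (≡.trans (centre′-old j≤K) centre≡u)) x~u
    ... | inj₂ centre≡v = subst (Adj G x) (≡.sym (≡.trans (centre′-old j≤K) centre≡v)) x~v

    anchor-lift : ∀ {y z} → T y → T z → Anchor K level centre y z → Anchor (suc K) level′ centre′ y z
    anchor-lift {y} {z} y∈T z∈T α = record
      { j = α.j ; 1≤j = α.1≤j ; j≤K = m≤n⇒m≤1+n α.j≤K
      ; u∈prefix = prefix-embed _ y α.u∈prefix ; v∈prefix = prefix-embed _ z α.v∈prefix
      ; centre-endpoint = ⊎.map (≡.trans (centre′-old α.j≤K)) (≡.trans (centre′-old α.j≤K)) ∘′ α.centre-endpoint
      ; later-centres-avoid = avoid
      }
      where
        module α = Anchor α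
        avoid : ∀ l → α.j < l → l ≤ suc K → centre′ l ≢ y × centre′ l ≢ z
        avoid l j<l l≤1+K with m≤n⇒m<n∨m≡n l≤1+K
        ... | inj₁ (s≤s l≤K) = let (≢y , ≢z) = α.later-centres-avoid l j<l l≤K
                               in (≢y ∘′ ≡.trans (≡.sym (centre′-old l≤K))) , (≢z ∘′ ≡.trans (≡.sym (centre′-old l≤K)))
        ... | inj₂ refl      = (λ x≡y → x∉T (subst T (≡.sym (≡.trans (≡.sym centre′-new) x≡y)) y∈T))
                             , (λ x≡z → x∉T (subst T (≡.sym (≡.trans (≡.sym centre′-new) x≡z)) z∈T))

    new-anchor : ∀ {w} → T w → Anchor (suc K) level′ centre′ x w
    new-anchor {w} w∈T = record
      { j = suc K ; 1≤j = s≤s z≤n ; j≤K = ≤-refl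
      ; u∈prefix = j , j≤K , x∈level′ ; v∈prefix = prefix-embed K w (T⊆prefix w w∈T)
      ; centre-endpoint = λ _ → inj₁ centre′-new
      ; later-centres-avoid = λ _ 1+K<l l≤1+K → contradiction (≤-trans 1+K<l l≤1+K) (1+n≰n)
      }

    anchor′ : ∀ y z → T′ y → T′ z → Adj G y z → Anchor (suc K) level′ centre′ y z
    anchor′ y z y∈T′ z∈T′ y~z with Equivalence.to (T′≐ y) y∈T′ | Equivalence.to (T′≐ z) z∈T′
    ... | inj₁ y∈T | inj₁ z∈T = anchor-lift y∈T z∈T (anchor y z y∈T z∈T y~z)
    ... | inj₂ refl | inj₁ z∈T = new-anchor z∈T
    ... | inj₁ y∈T | inj₂ refl = anchor-swap (new-anchor y∈T)
    ... | inj₂ refl | inj₂ refl = contradiction y~z (irrefl G)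

    layering′ : Layering T′
    layering′ = record
      { K = suc K ; level = level′ ; centre = centre′ ; levelling = levelling′
      ; centre-in-prefix = centre-in-prefix′
      ; centre-degree-two = centre-degree-two′
      ; centre-adjacent = centre-adjacent′
      ; anchor = anchor′
      }

  layering : ∀ {T} → TwoTreeOn G T → Layering T
  layering (triangle a b c a≢b b≢c a≢c a~b b~c a~c T≐) = Triangle.layering a b c a≢b b≢c a≢c a~b b~c a~c T≐
  layering (extend x u v t x∉S u∈S v∈S u~v x~u x~v x-nbrs T≐) =
    Extend.layering′ (layering t) x u v x∉S u∈S v∈S u~v x~u x~v x-nbrs T≐

  decomposition : IsTwoTree G → Σ ℕ λ K → Σ Levels λ L → Decomposition K L
  decomposition t = K , level , record
    { levelling = levelling
    ; centred = λ i 2≤i i≤K → centre i , centre-in-prefix i 2≤i i≤K , centre-adjacent i 2≤i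
                            , centre-degree-two i 2≤i i≤K
    }
    where open Layering (layering t)

  prefix-≐-suc : ∀ {L} m → (∀ v → ¬ L (suc m) v) → Prefix L m ≐′ Prefix L (suc m)
  prefix-≐-suc {L} m Lₘ₊₁-empty = prefix-mono {L} (n≤1+n m) , back
    where
      back : Prefix L (suc m) ⊆′ Prefix L m
      back w (j , j≤1+m , w∈L) with m≤n⇒m<n∨m≡n j≤1+m
      ... | inj₁ (s≤s j≤m) = j , j≤m , w∈L
      ... | inj₂ refl      = contradiction w∈L (Lₘ₊₁-empty w)

  module DeleteLevel {K L} (D : Decomposition (suc K) L) (d : ℕ) (2≤d : 2 ≤ d) (d≤1+K : d ≤ suc K)
                     (Ld-empty : ∀ v → ¬ L d v) where
    open Decomposition D

    skip : ℕ → ℕ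
    skip i with i <? d
    ... | yes _ = i
    ... | no _  = suc i

    L′ : Levels
    L′ i = L (skip i)

    skip-below : ∀ {i} → i < d → skip i ≡ i
    skip-below {i} i<d with i <? d
    ... | yes _   = refl
    ... | no i≮d = contradiction i<d i≮d

    skip-above : ∀ {i} → ¬ i < d → skip i ≡ suc i
    skip-above {i} i≮d with i <? d
    ... | yes i<d = contradiction i<d i≮d
    ... | no _    = refl

    i≤skip : ∀ i → i ≤ skip i
    i≤skip i with i <? d
    ... | yes _ = ≤-refl
    ... | no _  = n≤1+n i

    skip-<-mono : ∀ {i i′} → i < i′ → skip i < skip i′
    skip-<-mono {i} {i′} i<i′ with i <? d | i′ <? d
    ... | yes _   | yes _    = i<i′
    ... | yes _   | no _     = m<n⇒m<1+n i<i′
    ... | no i≮d  | yes i′<d = contradiction (<-trans i<i′ i′<d) i≮d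
    ... | no _    | no _     = s≤s i<i′

    skip-mono-≤ : ∀ {i i′} → i ≤ i′ → skip i ≤ skip i′
    skip-mono-≤ i≤i′ with m≤n⇒m<n∨m≡n i≤i′
    ... | inj₁ i<i′ = <⇒≤ (skip-<-mono i<i′)
    ... | inj₂ refl = ≤-refl

    skip-cancel-≤ : ∀ {i i′} → skip i ≤ skip i′ → i ≤ i′
    skip-cancel-≤ {i} {i′} le with i ≤? i′
    ... | yes i≤i′ = i≤i′
    ... | no i≰i′  = contradiction le (<⇒≱ (skip-<-mono (≰⇒> i≰i′)))

    skip-injective : ∀ {i i′} → skip i ≡ skip i′ → i ≡ i′
    skip-injective eq = ≤-antisym (skip-cancel-≤ (≤-reflexive eq)) (skip-cancel-≤ (≤-reflexive (≡.sym eq)))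

    skip-onto : ∀ j → j ≢ d → ∃ λ i → skip i ≡ j
    skip-onto j j≢d with j <? d
    ... | yes j<d = j , skip-below j<d
    skip-onto zero    j≢d | no j≮d = contradiction (≤-trans (s≤s z≤n) 2≤d) j≮d
    skip-onto (suc j) j≢d | no 1+j≮d = j , skip-above λ j<d → 1+j≮d (≤∧≢⇒< j<d j≢d)

    skip-onto-levels : ∀ j w → L j w → ∃ λ i → skip i ≡ j
    skip-onto-levels j w w∈Lⱼ = skip-onto j λ { refl → Ld-empty w w∈Lⱼ }

    prefix-skip : ∀ m → Prefix L′ m ≐′ Prefix L (skip m)
    prefix-skip m = (λ w (i , i≤m , w∈L) → skip i , skip-mono-≤ i≤m , w∈L) , back
      where
        back : Prefix L (skip m) ⊆′ Prefix L′ m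
        back w (j , j≤skip-m , w∈Lⱼ) with skip-onto-levels j w w∈Lⱼ
        ... | i , refl = i , skip-cancel-≤ j≤skip-m , w∈Lⱼ

    prefix-skip-∸1-comm : ∀ i → 1 ≤ i → Prefix L (skip (i ∸ 1)) ≐′ Prefix L (skip i ∸ 1)
    prefix-skip-∸1-comm (suc i) _ with i <? d | suc i <? d
    ... | yes _   | yes _     = ≐′-refl
    ... | yes i<d | no 1+i≮d with m≤n⇒m<n∨m≡n i<d
    ...   | inj₁ 1+i<d = contradiction 1+i<d 1+i≮d
    ...   | inj₂ refl  = prefix-≐-suc i Ld-empty
    prefix-skip-∸1-comm (suc i) _ | no i≮d | yes 1+i<d = contradiction (<⇒≤ 1+i<d) i≮d
    prefix-skip-∸1-comm (suc i) _ | no _   | no _      = ≐′-refl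

    prefix-skip-pred : ∀ i → 1 ≤ i → Prefix L′ (i ∸ 1) ≐′ Prefix L (skip i ∸ 1)
    prefix-skip-pred i 1≤i = ≐′-trans (prefix-skip (i ∸ 1)) (prefix-skip-∸1-comm i 1≤i)

    skip≤1+K⇒≤K : ∀ i → skip i ≤ suc K → i ≤ K
    skip≤1+K⇒≤K i skip-i≤1+K with i <? d
    ... | yes i<d = ≤-pred (<-≤-trans i<d d≤1+K)
    ... | no _    = ≤-pred skip-i≤1+K

    ≤K⇒skip≤1+K : ∀ i → i ≤ K → skip i ≤ suc K
    ≤K⇒skip≤1+K i i≤K with i <? d
    ... | yes _ = m≤n⇒m≤1+n i≤K
    ... | no _  = s≤s i≤K

    decomposition′ : Decomposition K L′
    decomposition′ = record
      { levelling = record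
        { 1≤K = ≤-pred (≤-trans 2≤d d≤1+K)
        ; level? = λ i → level? (skip i)
        ; level≤K = λ i w w∈L → skip≤1+K⇒≤K i (level≤K (skip i) w w∈L)
        ; covers = covers′
        ; within = λ _ _ _ → tt
        ; disjoint = λ i i′ w w∈L w∈L′ → skip-injective (disjoint (skip i) (skip i′) w w∈L w∈L′)
        ; a = a ; b = b ; a~b = a~b
        ; level₀ = λ w → ≡.subst (λ j → L j w ⇔ (w ≡ a ⊎ w ≡ b)) (≡.sym skip-0) (level₀ w)
        ; level₁-nonempty = ≡.subst (λ j → ∃ (L j)) (≡.sym skip-1) level₁-nonempty
        ; prefix-twoTree = λ i 1≤i → twoTree-resp-≐ (≐′-sym (prefix-skip i))
                                       (prefix-twoTree (skip i) (≤-trans 1≤i (i≤skip i)))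
        ; level-independent = λ i 1≤i → level-independent (skip i) (≤-trans 1≤i (i≤skip i))
        ; level-attached = attached′
        }
      ; centred = centred′
      }
      where
        skip-0 : skip 0 ≡ 0
        skip-0 = skip-below (≤-trans (s≤s z≤n) 2≤d)

        skip-1 : skip 1 ≡ 1
        skip-1 = skip-below 2≤d

        covers′ : ∀ w → ⊤ → ∃ λ i → L′ i w
        covers′ w _ with covers w tt
        ... | j , w∈Lⱼ with skip-onto-levels j w w∈Lⱼ
        ...   | i , refl = i , w∈Lⱼ

        attached′ : ∀ i → 1 ≤ i → ∀ x → L′ i x → ∃₂ λ u w →
                      NbrsExactly G (Prefix L′ (i ∸ 1)) x u w × Adj G u w
        attached′ i 1≤i x x∈L with level-attached (skip i) (≤-trans 1≤i (i≤skip i)) x x∈L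
        ... | u , w , nbrs , u~w = u , w , nbrsExactly-resp-≐ (≐′-sym (prefix-skip-pred i 1≤i)) nbrs , u~w

        centred′ : ∀ i → 2 ≤ i → i ≤ K → HasCentre L′ i
        centred′ i 2≤i i≤K with centred (skip i) (≤-trans 2≤i (i≤skip i)) (≤K⇒skip≤1+K i i≤K)
        ... | v , v∈prefix , v~level , nbrs =
          v , proj₂ (prefix-skip-pred i 1≤i) v v∈prefix , v~level
            , degreeTwo-resp-≐ (≐′-sym (prefix-skip-pred i 1≤i)) nbrs
          where 1≤i = ≤-trans (s≤s z≤n) 2≤i

  compact : ∀ {K L} → Decomposition K L →
            Σ ℕ λ K′ → Σ Levels λ L′ → Decomposition K′ L′ × (∀ j → j ≤ K′ → ∃ (L′ j))
  compact {zero} D = contradiction (Decomposition.1≤K D) λ ()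
  compact {suc K} {L} D with anyUpTo? (λ d → (2 ≤? d) ×-dec ¬? (any? (Decomposition.level? D d))) (suc (suc K))
  ... | yes (d , d<2+K , 2≤d , Ld-empty) =
    compact (DeleteLevel.decomposition′ D d 2≤d (≤-pred d<2+K) (λ v v∈L → Ld-empty (v , v∈L)))
  ... | no no-empty-level = suc K , L , D , nonempty
    where
      open Decomposition D
      nonempty : ∀ j → j ≤ suc K → ∃ (L j)
      nonempty zero          _     = a , Equivalence.from (level₀ a) (inj₁ refl)
      nonempty (suc zero)    _     = level₁-nonempty
      nonempty (suc (suc j)) j≤1+K = decidable-stable (any? (level? (suc (suc j))))
        λ empty → no-empty-level (suc (suc j) , s≤s j≤1+K , s≤s (s≤s z≤n) , empty)

  module Reindex {K L} (D : Decomposition K L) (nonempty : ∀ j → j ≤ K → ∃ (L j)) where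
    open Decomposition D

    S : Fin (suc K) → VSet n
    S i = L (toℕ i)

    level-index : ∀ {j v} → L j v → Σ (Fin (suc K)) λ i → toℕ i ≡ j
    level-index {j} {v} v∈L = fromℕ< (s≤s (level≤K j v v∈L)) , toℕ-fromℕ< (s≤s (level≤K j v v∈L))

    upto≐prefix : ∀ m → Upto S m ≐′ Prefix L m
    upto≐prefix m = (λ w (i , i≤m , w∈S) → toℕ i , i≤m , w∈S) , back
      where
        back : Prefix L m ⊆′ Upto S m
        back w (j , j≤m , w∈L) with level-index w∈L
        ... | i , refl = i , j≤m , w∈L

    partition : IsPartition S
    partition = cover , (λ i i′ v v∈S v∈S′ → toℕ-injective (disjoint (toℕ i) (toℕ i′) v v∈S v∈S′))
              , (λ i → nonempty (toℕ i) (≤-pred (toℕ<n i)))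
      where
        cover : ∀ v → Σ (Fin (suc K)) λ i → S i v
        cover v with covers v tt
        ... | j , v∈L with level-index v∈L
        ...   | i , refl = i , v∈L

    upto-twoTree : ∀ (i : Fin (suc K)) → 1 ≤ toℕ i → TwoTreeOn G (Upto S (toℕ i))
    upto-twoTree i 1≤i = twoTree-resp-≐ (≐′-sym (upto≐prefix (toℕ i))) (prefix-twoTree (toℕ i) 1≤i)

    attached : ∀ i → 1 ≤ toℕ i → ∀ x → S i x → ∃₂ λ u w →
                 NbrsExactly G (Upto S (toℕ i ∸ 1)) x u w × Adj G u w
    attached i 1≤i x x∈S with level-attached (toℕ i) 1≤i x x∈S
    ... | u , w , nbrs , u~w = u , w , nbrsExactly-resp-≐ (≐′-sym (upto≐prefix _)) nbrs , u~w

    centre : ∀ i → 2 ≤ toℕ i → Σ (Fin n) λ v → Upto S (toℕ i ∸ 1) v ×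
               (∀ x → S i x → Adj G x v) × DegreeTwoIn G (Upto S (toℕ i ∸ 1)) v
    centre i 2≤i with centred (toℕ i) 2≤i (≤-pred (toℕ<n i))
    ... | v , v∈prefix , v~level , nbrs =
      v , proj₂ (upto≐prefix _) v v∈prefix , v~level , degreeTwo-resp-≐ (≐′-sym (upto≐prefix _)) nbrs

open LevelStructure

mainTheorem10 : (n : ℕ) (G : Graph n) → IsTwoTree G →
    Σ ℕ λ k → 1 ≤ k × Σ (Fin (suc k) → VSet n) λ S →
      IsPartition S ×
      -- (a) G_i = G[S_0 ∪ … ∪ S_i] is a 2-tree for 1 ≤ i ≤ k
      (∀ (i : Fin (suc k)) → 1 ≤ toℕ i → TwoTreeOn G (Upto S (toℕ i))) ×
      -- (b) S_0 consists of two adjacent vertices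
      (Σ (Fin n) λ a → Σ (Fin n) λ b →
         Adj G a b × (∀ v → S Fin.zero v ⇔ (v ≡ a ⊎ v ≡ b))) ×
      -- (c) S_i is independent for 1 ≤ i ≤ k
      (∀ (i : Fin (suc k)) → 1 ≤ toℕ i →
         ∀ u v → S i u → S i v → ¬ Adj G u v) ×
      -- (d) each x ∈ S_i has exactly two neighbours in G_{i-1}, and they are adjacent
      (∀ (i : Fin (suc k)) → 1 ≤ toℕ i → ∀ x → S i x →
         Σ (Fin n) λ u → Σ (Fin n) λ w →
           NbrsExactly G (Upto S (toℕ i ∸ 1)) x u w × Adj G u w) ×
      -- (e) for 2 ≤ i ≤ k, S_i has a common neighbour v in G_{i-1} of degree two in G_{i-1}
      (∀ (i : Fin (suc k)) → 2 ≤ toℕ i →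
         Σ (Fin n) λ v → Upto S (toℕ i ∸ 1) v ×
           (∀ x → S i x → Adj G x v) ×
           DegreeTwoIn G (Upto S (toℕ i ∸ 1)) v)
mainTheorem10 n G t with decomposition G t
... | _ , _ , D₀ with compact G D₀
... | K , L , D , nonempty =
  K , 1≤K , S , partition , upto-twoTree , (a , b , a~b , level₀)
    , (λ i → level-independent (toℕ i)) , attached , centre
  where
    open Decomposition D
    open Reindex G D nonempty
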